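{- Let $p$ be a prime, and let $c\in\mathbb{N}$, $d\in\mathbb{N}^{*}$ with $\gcd(c,p)=1$, $\gcd(d,p)=1$ and $\gcd(c,d)=1$. Define sequences $(\alpha_i)_{i\ge 0}$ and $(\beta_i)_{i\ge 0}$ by $$\beta_0=c,\qquad \alpha_i=\beta_i d^{ -1}\bmod p\ \ (i\ge 0),\qquad \beta_{i+1}=\frac{\beta_i-\alpha_i d}{p}\in\mathbb{Z}\ \ (i\ge 0).$$ Then: (1) If $c<d$, then $0\le|\beta_i|<d$ for all $i\in\mathbb{N}$. (2) Suppose $c>d$ and $p\ge 3$. (2.1) If $0<\frac{c(p-1)}{2dp}<1$, then $|\beta_i|<d$ for all $i\in\mathbb{N}^{*}$. (2.2) If $1<\frac{c(p-1)}{2dp}$, let $m=\left\lfloor \dfrac{\log\left(\frac{c(p-1)}{2dp}\right)}{\log p}\right\rfloor$. Then $d<|\beta_i|\le c$ for $0\le i<m+1$; $0\le|\beta_i|<d$ for $i>m+1$; and $0\le|\beta_i|<c$ for $i=m+1$.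
   Context: For an integer $b$ and an integer $d$ coprime to $p$, the notation $b\,d^{ -1}\bmod p$ denotes the unique element of $\{0,1,\dots,p-1\}$ congruent modulo $p$ to $b\cdot d'$, where $d'$ is an inverse of $d$ modulo $p$. $\lfloor x\rfloor$ denotes the integer part of $x$. -}

module Defs where

open import Data.Nat as ℕ using (ℕ; zero; suc; NonZero)
open import Data.Integer using (ℤ; +_; _-_; _*_; _%ℕ_; _/ℕ_)

-- The digit α = b · d⁻¹ mod p, where d' is a (given) inverse of d modulo p.
-- Result lies in {0,…,p-1} (_%ℕ_ is the nonnegative residue).
alpha : (p d' : ℕ) .{{_ : NonZero p}} → ℤ → ℕ
alpha p d' b = (b * + d') %ℕ p

-- β₀ = c, β_{i+1} = (β_i − α_i d)/p  (the division is exact; _/ℕ_ is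
-- integer division, which returns the exact quotient in that case).
beta : (p d d' : ℕ) .{{_ : NonZero p}} → ℤ → ℕ → ℤ
beta p d d' c zero = c
beta p d d' c (suc i) =
  let b = beta p d d' c i in (b - (+ alpha p d' b) * + d) /ℕ p

alphaSeq : (p d d' : ℕ) .{{_ : NonZero p}} → ℤ → ℕ → ℕ
alphaSeq p d d' c i = alpha p d' (beta p d d' c i)

module Submission where

open import Defs

-- Unrolling β_{i+1} = (β_i − α_i d)/p gives p^i β_i = c − d Σ_{j<i} α_j p^j with digits
-- 0 ≤ α_j < p, hence p^i β_i ≤ c and c + d ≤ p^i (β_i + d).  So −d < β_i ≤ c/p^i, which
-- gives |β_i| < d once c < p^i d and |β_i| < c once p^i ≥ 2, while β_i ≥ (c + d)/p^i − d
-- gives β_i > d as long as 2 p^i d < c.  The hypotheses on c(p−1)/(2dp) locate these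
-- thresholds.  Only d d' ≡ 1 (mod p) is used, to make every division exact.

module Digits where
  open import Data.Nat as ℕ using (ℕ)
  import Data.Nat.Properties as ℕ
  import Data.Nat.DivMod as ℕ using (m≡m%n+[m/n]*n)
  open import Data.Integer
  open import Data.Integer.Properties
  open import Data.Integer.DivMod using (a≡a%ℕn+[a/ℕn]*n; n%ℕd<d; [n/ℕd]*d≤n; n<s[n/ℕd]*d)
  open import Data.Integer.Tactic.RingSolver using (solve-∀)
  open import Data.Product using (_×_; _,_)
  open import Relation.Binary.PropositionalEquality

  [i*n]/ℕn≡i : ∀ i n .{{_ : ℕ.NonZero n}} → (i * + n) /ℕ n ≡ i
  [i*n]/ℕn≡i i n@(ℕ.suc _) = ≤-antisym q≤i i≤q
    where
    q : ℤ
    q = (i * + n) /ℕ n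
    q≤i : q ≤ i
    q≤i = *-cancelʳ-≤-pos q i (+ n) ([n/ℕd]*d≤n (i * + n) n)
    i≤q : i ≤ q
    i≤q = subst (i ≤_) (pred-suc q)
            (i<j⇒i≤pred[j] {j = suc q} (*-cancelʳ-<-nonNeg (+ n) (n<s[n/ℕd]*d (i * + n) n)))

  +-cancelʳ-< : ∀ i j k → i + k < j + k → i < j
  +-cancelʳ-< i j k lt = subst₂ _<_ (cancel i k) (cancel j k) (+-monoˡ-< (- k) lt)
    where
    cancel : ∀ x k → x + k - k ≡ x
    cancel = solve-∀

  b-a*d≡[q*d-b*k]*p : ∀ {a b d d' k p q} → b * d' ≡ a + q * p → d * d' ≡ + 1 + k * p →
                      b - a * d ≡ (q * d - b * k) * p
  b-a*d≡[q*d-b*k]*p {a} {b} {d} {d'} {k} {p} {q} b*d'≡a+q*p d*d'≡1+k*p = begin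
    b - a * d                                                  ≡⟨ expand a b d k p q ⟩
    (q * d - b * k) * p + (b * (+ 1 + k * p) - (a + q * p) * d)
      ≡⟨ cong₂ (λ u v → (q * d - b * k) * p + (b * u - v * d)) d*d'≡1+k*p b*d'≡a+q*p ⟨
    (q * d - b * k) * p + (b * (d * d') - b * d' * d)          ≡⟨ collapse ((q * d - b * k) * p) b d d' ⟩
    (q * d - b * k) * p                                        ∎
    where
    open ≡-Reasoning
    expand : ∀ a b d k p q → b - a * d ≡ (q * d - b * k) * p + (b * (+ 1 + k * p) - (a + q * p) * d)
    expand = solve-∀
    collapse : ∀ x b d d' → x + (b * (d * d') - b * d' * d) ≡ x
    collapse = solve-∀

  0<i+n∧i<n⇒∣i∣<n : ∀ i n → 0ℤ < i + + n → i < + n → ∣ i ∣ ℕ.< n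
  0<i+n∧i<n⇒∣i∣<n (+ m) n _ i<n = drop‿+<+ i<n
  0<i+n∧i<n⇒∣i∣<n -[1+ m ] n 0<i+n _ =
    drop‿+<+ (subst (+ ℕ.suc m <_) (-s+n+s≡n (+ ℕ.suc m) (+ n)) (+-monoˡ-< (+ ℕ.suc m) 0<i+n))
    where
    -s+n+s≡n : ∀ s n → (- s + n) + s ≡ n
    -s+n+s≡n = solve-∀

  module DigitExpansion (p d : ℕ) (x : ℕ → ℤ) (a : ℕ → ℕ) (a<p : ∀ i → a i ℕ.< p)
                        (step : ∀ i → + p * x (ℕ.suc i) + + (a i ℕ.* d) ≡ x i) where

    p*x′≤x : ∀ i → + p * x (ℕ.suc i) ≤ x i
    p*x′≤x i = subst (+ p * x (ℕ.suc i) ≤_) (step i) (i≤i+j (+ p * x (ℕ.suc i)) (+ (a i ℕ.* d)))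

    x+d≤p*[x′+d] : ∀ i → x i + + d ≤ + p * (x (ℕ.suc i) + + d)
    x+d≤p*[x′+d] i = begin
      x i + + d                                ≡⟨ cong (_+ + d) (step i) ⟨
      + p * x′ + + (a i ℕ.* d) + + d           ≡⟨ +-assoc (+ p * x′) _ _ ⟩
      + p * x′ + (+ (a i ℕ.* d) + + d)         ≤⟨ +-monoʳ-≤ (+ p * x′) ad+d≤pd ⟩
      + p * x′ + + p * + d                     ≡⟨ *-distribˡ-+ (+ p) x′ (+ d) ⟨
      + p * (x′ + + d)                         ∎
      where
      open ≤-Reasoning
      x′ : ℤ
      x′ = x (ℕ.suc i)
      ad+d≤pd : + (a i ℕ.* d) + + d ≤ + p * + d
      ad+d≤pd = subst₂ _≤_ (pos-+ (a i ℕ.* d) d) (pos-* p d)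
                  (+≤+ (subst (ℕ._≤ p ℕ.* d) (ℕ.+-comm d _) (ℕ.*-monoˡ-≤ d (a<p i))))

    p^[1+i]*y≡p^i*[p*y] : ∀ i y → + (p ℕ.^ ℕ.suc i) * y ≡ + (p ℕ.^ i) * (+ p * y)
    p^[1+i]*y≡p^i*[p*y] i y = begin
      + (p ℕ.^ ℕ.suc i) * y       ≡⟨ cong (_* y) (pos-* p (p ℕ.^ i)) ⟩
      + p * + (p ℕ.^ i) * y       ≡⟨ cong (_* y) (*-comm (+ p) _) ⟩
      + (p ℕ.^ i) * + p * y       ≡⟨ *-assoc (+ (p ℕ.^ i)) (+ p) y ⟩
      + (p ℕ.^ i) * (+ p * y)     ∎
      where open ≡-Reasoning

    p^i*x≤x₀ : ∀ i → + (p ℕ.^ i) * x i ≤ x 0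
    p^i*x≤x₀ ℕ.zero = ≤-reflexive (*-identityˡ (x 0))
    p^i*x≤x₀ (ℕ.suc i) = begin
      + (p ℕ.^ ℕ.suc i) * x (ℕ.suc i)    ≡⟨ p^[1+i]*y≡p^i*[p*y] i _ ⟩
      + (p ℕ.^ i) * (+ p * x (ℕ.suc i))  ≤⟨ *-monoˡ-≤-nonNeg (+ (p ℕ.^ i)) (p*x′≤x i) ⟩
      + (p ℕ.^ i) * x i                  ≤⟨ p^i*x≤x₀ i ⟩
      x 0                                ∎
      where open ≤-Reasoning

    x₀+d≤p^i*[x+d] : ∀ i → x 0 + + d ≤ + (p ℕ.^ i) * (x i + + d)
    x₀+d≤p^i*[x+d] ℕ.zero = ≤-reflexive (sym (*-identityˡ (x 0 + + d)))
    x₀+d≤p^i*[x+d] (ℕ.suc i) = begin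
      x 0 + + d                                  ≤⟨ x₀+d≤p^i*[x+d] i ⟩
      + (p ℕ.^ i) * (x i + + d)                  ≤⟨ *-monoˡ-≤-nonNeg (+ (p ℕ.^ i)) (x+d≤p*[x′+d] i) ⟩
      + (p ℕ.^ i) * (+ p * (x (ℕ.suc i) + + d))  ≡⟨ p^[1+i]*y≡p^i*[p*y] i _ ⟨
      + (p ℕ.^ ℕ.suc i) * (x (ℕ.suc i) + + d)    ∎
      where open ≤-Reasoning

  module Enclosure {Q c d : ℕ} {β : ℤ} (0<d : 0 ℕ.< d)
                   (upper : + Q * β ≤ + c) (lower : + c + + d ≤ + Q * (β + + d)) where

    0<β+d : 0ℤ < β + + d
    0<β+d = *-cancelˡ-<-nonNeg (+ Q) (subst (_< + Q * (β + + d)) (sym (*-zeroʳ (+ Q)))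
              (<-≤-trans 0<c+d lower))
      where
      0<c+d : 0ℤ < + c + + d
      0<c+d = subst (0ℤ <_) (pos-+ c d) (+<+ (ℕ.<-≤-trans 0<d (ℕ.m≤n+m d c)))

    β<n⇐c<Q*n : ∀ {n} → c ℕ.< Q ℕ.* n → β < + n
    β<n⇐c<Q*n {n} c<Qn =
      *-cancelˡ-<-nonNeg (+ Q) (≤-<-trans upper (subst (+ c <_) (pos-* Q n) (+<+ c<Qn)))

    ∣β∣<d : c ℕ.< Q ℕ.* d → ∣ β ∣ ℕ.< d
    ∣β∣<d c<Qd = 0<i+n∧i<n⇒∣i∣<n β d 0<β+d (β<n⇐c<Q*n c<Qd)

    ∣β∣<c : 2 ℕ.≤ Q → d ℕ.< c → ∣ β ∣ ℕ.< c
    ∣β∣<c 2≤Q d<c = 0<i+n∧i<n⇒∣i∣<n β c 0<β+c (β<n⇐c<Q*n c<Qc)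
      where
      0<β+c : 0ℤ < β + + c
      0<β+c = <-≤-trans 0<β+d (+-monoʳ-≤ β (+≤+ (ℕ.<⇒≤ d<c)))
      c<Qc : c ℕ.< Q ℕ.* c
      c<Qc = subst (c ℕ.<_) (ℕ.*-comm c Q)
               (ℕ.m<m*n c Q {{ℕ.>-nonZero (ℕ.<-trans 0<d d<c)}} 2≤Q)

    d<∣β∣≤c : 0 ℕ.< Q → 2 ℕ.* (Q ℕ.* d) ℕ.< c → d ℕ.< ∣ β ∣ × ∣ β ∣ ℕ.≤ c
    d<∣β∣≤c 0<Q 2Qd<c = drop‿+<+ (subst (+ d <_) (sym +∣β∣≡β) d<β) , drop‿+≤+ ∣β∣≤c
      where
      2*[Q*d]≡Qd+Qd : + (2 ℕ.* (Q ℕ.* d)) ≡ + Q * + d + + Q * + d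
      2*[Q*d]≡Qd+Qd = trans (pos-* 2 (Q ℕ.* d))
                        (trans (cong (+ 2 *_) (pos-* Q d)) (2*y≡y+y (+ Q * + d)))
        where
        2*y≡y+y : ∀ y → + 2 * y ≡ y + y
        2*y≡y+y = solve-∀
      Qd<Qβ : + Q * + d < + Q * β
      Qd<Qβ = +-cancelʳ-< (+ Q * + d) (+ Q * β) (+ Q * + d) (begin-strict
        + Q * + d + + Q * + d    ≡⟨ 2*[Q*d]≡Qd+Qd ⟨
        + (2 ℕ.* (Q ℕ.* d))      <⟨ +<+ 2Qd<c ⟩
        + c                      ≤⟨ i≤i+j (+ c) (+ d) ⟩
        + c + + d                ≤⟨ lower ⟩
        + Q * (β + + d)          ≡⟨ *-distribˡ-+ (+ Q) β (+ d) ⟩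
        + Q * β + + Q * + d      ∎)
        where open ≤-Reasoning
      d<β : + d < β
      d<β = *-cancelˡ-<-nonNeg (+ Q) Qd<Qβ
      +∣β∣≡β : + ∣ β ∣ ≡ β
      +∣β∣≡β = 0≤i⇒+∣i∣≡i (≤-trans (+≤+ ℕ.z≤n) (<⇒≤ d<β))
      ∣β∣≤c : + ∣ β ∣ ≤ + c
      ∣β∣≤c = begin
        + ∣ β ∣            ≡⟨ *-identityˡ (+ ∣ β ∣) ⟨
        + 1 * + ∣ β ∣      ≤⟨ *-monoʳ-≤-nonNeg (+ ∣ β ∣) (+≤+ 0<Q) ⟩
        + Q * + ∣ β ∣      ≡⟨ cong (+ Q *_) +∣β∣≡β ⟩
        + Q * β            ≤⟨ upper ⟩
        + c                ∎
        where open ≤-Reasoning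

  module Recurrence (p d d' : ℕ) .{{_ : ℕ.NonZero p}} (d*d'%p≡1 : (d ℕ.* d') ℕ.% p ≡ 1) where

    k : ℕ
    k = (d ℕ.* d') ℕ./ p

    d*d'≡1+k*p : + d * + d' ≡ + 1 + + k * + p
    d*d'≡1+k*p = begin
      + d * + d'                                ≡⟨ pos-* d d' ⟨
      + (d ℕ.* d')                              ≡⟨ cong +_ (ℕ.m≡m%n+[m/n]*n (d ℕ.* d') p) ⟩
      + ((d ℕ.* d') ℕ.% p ℕ.+ k ℕ.* p)          ≡⟨ cong (λ r → + (r ℕ.+ k ℕ.* p)) d*d'%p≡1 ⟩
      + (1 ℕ.+ k ℕ.* p)                         ≡⟨ pos-+ 1 (k ℕ.* p) ⟩
      + 1 + + (k ℕ.* p)                         ≡⟨ cong (_+_ (+ 1)) (pos-* k p) ⟩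
      + 1 + + k * + p                           ∎
      where open ≡-Reasoning

    digit-step : ∀ b → + p * ((b - + alpha p d' b * + d) /ℕ p) + + (alpha p d' b ℕ.* d) ≡ b
    digit-step b = begin
      + p * ((b - α * + d) /ℕ p) + + (alpha p d' b ℕ.* d)
        ≡⟨ cong₂ (λ u v → + p * u + v) quotient (pos-* (alpha p d' b) d) ⟩
      + p * w + α * + d
        ≡⟨ cong (_+ α * + d) (trans (*-comm (+ p) w) (sym b-α*d≡w*p)) ⟩
      b - α * + d + α * + d
        ≡⟨ minus-plus b (α * + d) ⟩
      b ∎
      where
      open ≡-Reasoning
      α : ℤ
      α = + alpha p d' b
      q : ℤ
      q = (b * + d') /ℕ p
      w : ℤ
      w = q * + d - b * + k
      b-α*d≡w*p : b - α * + d ≡ w * + p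
      b-α*d≡w*p = b-a*d≡[q*d-b*k]*p {a = α} {b} {q = q} (a≡a%ℕn+[a/ℕn]*n (b * + d') p) d*d'≡1+k*p
      quotient : (b - α * + d) /ℕ p ≡ w
      quotient = trans (cong (_/ℕ p) b-α*d≡w*p) ([i*n]/ℕn≡i w p)
      minus-plus : ∀ x y → x - y + y ≡ x
      minus-plus = solve-∀

    beta-enclosed : ∀ C i → + (p ℕ.^ i) * beta p d d' C i ≤ C
                          × C + + d ≤ + (p ℕ.^ i) * (beta p d d' C i + + d)
    beta-enclosed C i = p^i*x≤x₀ i , x₀+d≤p^i*[x+d] i
      where
      open DigitExpansion p d (beta p d d' C) (alphaSeq p d d' C)
             (λ j → n%ℕd<d (beta p d d' C j * + d') p) (λ j → digit-step _)

open import Data.Nat using (ℕ; suc; _+_; _*_; _∸_; _^_; _≤_; _<_; _>_; _≥_; NonZero; _%_)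
open import Data.Nat.GCD using (gcd)
open import Data.Nat.Primality using (Prime)
open import Data.Integer using (+_; ∣_∣)
open import Data.Product using (_×_)
open import Relation.Binary.PropositionalEquality using (_≡_)

open import Data.Nat using (>-nonZero)
open import Data.Nat.Properties
open import Data.Nat.Tactic.RingSolver using (solve-∀)
open import Data.Product using (_,_; proj₁; proj₂)
open import Relation.Binary.PropositionalEquality using (cong; subst; trans)
open Digits using (module Enclosure; module Recurrence)

m*n≤o*[n∸1]⇒m<o : ∀ {m n o} .{{_ : NonZero n}} → 0 < m → m * n ≤ o * (n ∸ 1) → m < o
m*n≤o*[n∸1]⇒m<o {m} {suc n} {o} 0<m mn≤on =
  *-cancelʳ-< n m o (<-≤-trans (*-monoʳ-< m {{>-nonZero 0<m}} (n<1+n n)) mn≤on)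

m*[n∸1]<2*o⇒m<o : ∀ {m n o} → 3 ≤ n → m * (n ∸ 1) < 2 * o → m < o
m*[n∸1]<2*o⇒m<o {m} {n} {o} 3≤n lt =
  *-cancelˡ-< 2 m o (≤-<-trans (subst (_≤ m * (n ∸ 1)) (*-comm m 2) (*-monoʳ-≤ m (∸-monoˡ-≤ 1 3≤n))) lt)

mainTheorem2 : (p c d d' : ℕ) .{{_ : NonZero p}} → Prime p → d ≥ 1
    → gcd c p ≡ 1 → gcd d p ≡ 1 → gcd c d ≡ 1
    → (d * d') % p ≡ 1
    → ((c < d → ∀ i → ∣ beta p d d' (+ c) i ∣ < d)
      × (c > d → p ≥ 3
        → ((0 < c * (p ∸ 1) → c * (p ∸ 1) < 2 * d * p
            → ∀ i → i ≥ 1 → ∣ beta p d d' (+ c) i ∣ < d)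
          × (2 * d * p < c * (p ∸ 1)
            → ∀ m → p ^ m * (2 * d * p) ≤ c * (p ∸ 1)
            → c * (p ∸ 1) < p ^ (suc m) * (2 * d * p)
            → (∀ i → i < m + 1 → d < ∣ beta p d d' (+ c) i ∣ × ∣ beta p d d' (+ c) i ∣ ≤ c)
              × (∀ i → i > m + 1 → ∣ beta p d d' (+ c) i ∣ < d)
              × ∣ beta p d d' (+ c) (m + 1) ∣ < c))))
mainTheorem2 p c d d' _ 0<d _ _ _ d*d'%p≡1 =
  small , λ d<c 3≤p → (λ _ → one-step 3≤p)
                    , λ _ m lo hi → before m lo , after 3≤p m hi , at 3≤p d<c m
  where
  open Recurrence p d d' d*d'%p≡1 using (beta-enclosed)
  module E (i : ℕ) = Enclosure {p ^ i} {c} {d} {beta p d d' (+ c) i} 0<d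
                       (proj₁ (beta-enclosed (+ c) i)) (proj₂ (beta-enclosed (+ c) i))

  p≤p^ : ∀ {i} → 1 ≤ i → p ≤ p ^ i
  p≤p^ 1≤i = ≤-trans (m≤m*n p 1) (^-monoʳ-≤ p 1≤i)

  small : c < d → ∀ i → ∣ beta p d d' (+ c) i ∣ < d
  small c<d i = E.∣β∣<d i (<-≤-trans c<d (m≤n*m d (p ^ i) {{m^n≢0 p i}}))

  one-step : p ≥ 3 → c * (p ∸ 1) < 2 * d * p → ∀ i → i ≥ 1 → ∣ beta p d d' (+ c) i ∣ < d
  one-step 3≤p c[p∸1]<2dp i 1≤i = E.∣β∣<d i (<-≤-trans c<pd (*-monoˡ-≤ d (p≤p^ 1≤i)))
    where
    2dp≡2*[pd] : ∀ d p → 2 * d * p ≡ 2 * (p * d)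
    2dp≡2*[pd] = solve-∀
    c<pd : c < p * d
    c<pd = m*[n∸1]<2*o⇒m<o 3≤p (subst (c * (p ∸ 1) <_) (2dp≡2*[pd] d p) c[p∸1]<2dp)

  before : ∀ m → p ^ m * (2 * d * p) ≤ c * (p ∸ 1)
         → ∀ i → i < m + 1 → d < ∣ beta p d d' (+ c) i ∣ × ∣ beta p d d' (+ c) i ∣ ≤ c
  before m p^m*2dp≤c[p∸1] i i<m+1 =
    E.d<∣β∣≤c i (m^n>0 p i) (m*n≤o*[n∸1]⇒m<o 0<2*p^i*d (begin
      2 * (p ^ i * d) * p    ≡⟨ reassoc (p ^ i) d p ⟩
      p ^ i * (2 * d * p)    ≤⟨ *-monoˡ-≤ (2 * d * p) (^-monoʳ-≤ p i≤m) ⟩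
      p ^ m * (2 * d * p)    ≤⟨ p^m*2dp≤c[p∸1] ⟩
      c * (p ∸ 1)            ∎))
    where
    open ≤-Reasoning
    reassoc : ∀ Q d p → 2 * (Q * d) * p ≡ Q * (2 * d * p)
    reassoc = solve-∀
    i≤m : i ≤ m
    i≤m = m<1+n⇒m≤n (subst (i <_) (+-comm m 1) i<m+1)
    0<2*p^i*d : 0 < 2 * (p ^ i * d)
    0<2*p^i*d = <-≤-trans (*-mono-≤ (m^n>0 p i) 0<d) (m≤m+n (p ^ i * d) _)

  after : p ≥ 3 → ∀ m → c * (p ∸ 1) < p ^ (suc m) * (2 * d * p)
        → ∀ i → i > m + 1 → ∣ beta p d d' (+ c) i ∣ < d
  after 3≤p m c[p∸1]<p^[1+m]*2dp i m+1<i =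
    E.∣β∣<d i (<-≤-trans c<p^[2+m]*d (*-monoˡ-≤ d (^-monoʳ-≤ p m+1<i)))
    where
    shift : ∀ Q d p → Q * (2 * d * p) ≡ 2 * (p * Q * d)
    shift = solve-∀
    c<p^[2+m]*d : c < p ^ suc (m + 1) * d
    c<p^[2+m]*d = m*[n∸1]<2*o⇒m<o 3≤p (subst (c * (p ∸ 1) <_)
      (trans (shift (p ^ suc m) d p) (cong (λ e → 2 * (p ^ suc e * d)) (+-comm 1 m)))
      c[p∸1]<p^[1+m]*2dp)

  at : p ≥ 3 → c > d → ∀ m → ∣ beta p d d' (+ c) (m + 1) ∣ < c
  at 3≤p d<c m = E.∣β∣<c (m + 1) (≤-trans (≤-trans (n≤1+n 2) 3≤p) (p≤p^ (m≤n+m 1 m))) d<c
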